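{- Let $n,h\ge2$, let $\mu$ be an integer with $h/2<\mu\le h$ and $p\in\mathcal{P}$. Then \[D_\mu(p)=\bigcup_{\Gamma\in\mathcal{C}(\Gamma_\mu(p))}\max(\Gamma)\supseteq\bigcup_{\Gamma\in\mathcal{A}(\Gamma_\mu(p))}\max(\Gamma)\supseteq\mathrm{I}(\Gamma_\mu(p)),\] and \[|D_\mu(p)|=\sum_{\Gamma\in\mathcal{C}(\Gamma_\mu(p))}|\max(\Gamma)|\ge|\mathcal{A}(\Gamma_\mu(p))|\ge|\mathrm{I}(\Gamma_\mu(p))|.\]
   Context: $N=\{1,\dots,n\}$, $H=\{1,\dots,h\}$, $\mathcal{P}=\mathcal{L}(N)^h$ the set of profiles of linear orders on $N$; $x>_{p_i}y$ means individual $i$ ranks $x$ above $y$. $D_\mu(p)=\{x\in N:\forall y\in N,\ |\{i: y>_{p_i}x\}|<\mu\}$. $\Gamma_\mu(p)$ is the directed graph on $N$ with arcs $(x,y)$ whenever $|\{i:x>_{p_i}y\}|\ge\mu$. For a directed graph, $\mathcal{C}$ denotes its set of connected components (components of the underlying undirected graph, as subgraphs), $\mathcal{A}$ the set of acyclic connected components (those containing no $l$-cycle for any $l\ge2$, where an $l$-cycle is a subgraph on $l$ vertices $x_1,\dots,x_l$ with arcs exactly $(x_j,x_{j+1})$, $x_{l+1}=x_1$), $\max(\Gamma)$ the set of vertices of $\Gamma$ with no incoming arc in $\Gamma$, and $\mathrm{I}$ the set of isolated vertices. -}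

module Defs where

open import Data.Nat using (ℕ; zero; suc; _≤_; _<_; _≤?_)
open import Data.Nat.Properties using ()
open import Data.Fin using (Fin; zero; suc; inject₁; fromℕ)
import Data.Fin.Properties as FinP
open import Data.Fin.Subset using (Subset; _∈_)
open import Data.Fin.Subset.Properties using (_∈?_)
open import Data.Fin.Permutation using (Permutation′; _⟨$⟩ʳ_)
open import Data.Vec using (count; allFin)
open import Data.List using (List; length)
open import Data.List.Membership.Propositional using () renaming (_∈_ to _∈ₗ_)
open import Data.List.Relation.Unary.Unique.Propositional using (Unique)
open import Data.Product using (Σ; ∃; ∃-syntax; _×_; _,_)
open import Data.Product.Properties using ()
open import Relation.Nullary using (¬_; Dec; yes; no)
open import Relation.Nullary.Decidable using (_×-dec_; ¬?)
open import Relation.Binary.Construct.Closure.ReflexiveTransitive using (Star)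
open import Data.Sum using (_⊎_)
open import Function.Bundles using (_⇔_)
open import Function using (Injective)
open import Relation.Binary.PropositionalEquality using (_≡_)

-- A linear order on N = Fin n is encoded by a permutation σ : Fin n ↔ Fin n
-- sending each alternative to its position (position 0 = top).
-- x >_σ y  iff  x has a strictly better (smaller) position than y.

LinOrd : ℕ → Set
LinOrd n = Permutation′ n

_>[_]_ : ∀ {n} → Fin n → LinOrd n → Fin n → Set
x >[ σ ] y = (σ ⟨$⟩ʳ x) Data.Fin.< (σ ⟨$⟩ʳ y)

_>[_]?_ : ∀ {n} (x : Fin n) (σ : LinOrd n) (y : Fin n) → Dec (x >[ σ ] y)
x >[ σ ]? y = (σ ⟨$⟩ʳ x) FinP.<? (σ ⟨$⟩ʳ y)

Profile : ℕ → ℕ → Set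
Profile n h = Fin h → LinOrd n

module _ {n h : ℕ} (μ : ℕ) (p : Profile n h) where

  support : Fin n → Fin n → ℕ
  support x y = count (λ i → x >[ p i ]? y) (allFin h)

  InD : Fin n → Set
  InD x = ∀ y → support y x < μ

  InD? : ∀ x → Dec (InD x)
  InD? x = FinP.all? (λ y → suc (support y x) ≤? μ)

  cardD : ℕ
  cardD = count InD? (allFin n)

  Arc : Fin n → Fin n → Set
  Arc x y = μ ≤ support x y

  Arc? : ∀ x y → Dec (Arc x y)
  Arc? x y = μ ≤? support x y

  Adj : Fin n → Fin n → Set
  Adj x y = Arc x y ⊎ Arc y x

  Connected : Fin n → Fin n → Set
  Connected = Star Adj

  -- Connected components, identified with their vertex sets
  -- (a component is the induced subgraph on its vertex set):
  -- nonempty, connected, and closed under adjacency (maximality).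
  IsComponent : Subset n → Set
  IsComponent S =
    (∃[ x ] x ∈ S)
    × (∀ x y → x ∈ S → y ∈ S → Connected x y)
    × (∀ x y → x ∈ S → Adj x y → y ∈ S)

  -- S contains an l-cycle (l ≥ 2): distinct vertices x₀ … x_{l-1} in S with
  -- arcs x_j → x_{j+1} and x_{l-1} → x₀.  Here l = suc (suc m).
  HasCycle : Subset n → Set
  HasCycle S = ∃[ m ] Σ (Fin (suc (suc m)) → Fin n) λ xs →
      Injective _≡_ _≡_ xs
    × (∀ j → xs j ∈ S)
    × (∀ (j : Fin (suc m)) → Arc (xs (inject₁ j)) (xs (suc j)))
    × Arc (xs (fromℕ (suc m))) (xs zero)

  IsAcyclicComponent : Subset n → Set
  IsAcyclicComponent S = IsComponent S × ¬ HasCycle S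

  InMax : Subset n → Fin n → Set
  InMax S x = x ∈ S × (∀ y → ¬ (y ∈ S × Arc y x))

  InMax? : ∀ S x → Dec (InMax S x)
  InMax? S x = (x ∈? S) ×-dec FinP.all? (λ y → ¬? ((y ∈? S) ×-dec Arc? y x))

  cardMax : Subset n → ℕ
  cardMax S = count (InMax? S) (allFin n)

  Isolated : Fin n → Set
  Isolated x = ∀ y → ¬ Arc x y × ¬ Arc y x

  Isolated? : ∀ x → Dec (Isolated x)
  Isolated? x = FinP.all? (λ y → ¬? (Arc? x y) ×-dec ¬? (Arc? y x))

  cardI : ℕ
  cardI = count Isolated? (allFin n)

Enumerates : ∀ {A : Set} → (A → Set) → List A → Set
Enumerates {A} P xs = Unique xs × (∀ a → (a ∈ₗ xs) ⇔ P a)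

-- A vertex x lies in D_μ(p) exactly when no arc of Γ_μ(p) enters it, i.e. when x is a maximal
-- vertex of its own connected component; since the components partition the vertices, counting
-- D_μ(p) amounts to summing the numbers of maximal vertices over the components.  Because μ > 0,
-- Γ_μ(p) has no loops, so a finite component without cycles has a maximal vertex: otherwise
-- walking backwards along incoming arcs must eventually revisit a vertex and close a cycle.
-- Finally, an isolated vertex forms an acyclic component on its own, and distinct isolated
-- vertices form distinct components.

module Submission where

open import Defs
import Data.Bool.Properties as Bool
open import Data.Empty using (⊥)
open import Data.Fin using (Fin; zero; suc; _≟_; inject₁; fromℕ)
open import Data.Fin.Properties using (any?; all?; <-irrefl; suc-injective; injective⇒≤)
open import Data.Fin.Subset using (Subset; _∈_; _⊆_; Nonempty)
open import Data.Fin.Subset.Properties using (_∈?_; _⊆?_; ⊆-antisym; anySubset?; nonempty?)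
open import Data.List using (List; []; _∷_; _++_; [_]; length; lookup; map; filter; deduplicate; allFin)
open import Data.List.Membership.Propositional using () renaming (_∈_ to _∈ₗ_)
open import Data.List.Membership.Propositional.Properties
  using (∈-map⁺; ∈-map⁻; ∈-allFin; ∈-filter⁺; ∈-filter⁻; ∈-deduplicate⁺; ∈-deduplicate⁻; ∈-lookup; ∈-∃++; ∈-++⁺ʳ)
open import Data.List.Properties using (map-cong; filter-notAll; length-tabulate)
open import Data.List.Relation.Unary.All as All using (All; []; _∷_)
open import Data.List.Relation.Unary.All.Properties using (++⁻ˡ; ¬Any⇒All¬)
open import Data.List.Relation.Unary.AllPairs using ([]; _∷_)
open import Data.List.Relation.Unary.Any as Any using (Any; here; there)
open import Data.List.Relation.Unary.Linked using (Linked; []; [-]; _∷_)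
open import Data.List.Relation.Unary.Unique.Propositional using (Unique)
open import Data.List.Relation.Unary.Unique.Propositional.Properties using (filter⁺)
open import Data.List.Relation.Unary.Unique.DecPropositional.Properties using (deduplicate-!)
open import Data.Nat using (ℕ; zero; suc; _+_; _≤_; _<_; _*_; _≥_; z≤n; s≤s)
open import Data.Nat.ListAction using (sum)
open import Data.Nat.Properties
  using (+-0-commutativeMonoid; +-mono-≤; +-suc; +-identityʳ; ≤-trans; ≤-reflexive; ≤-antisym; ≤-pred;
         <-≤-trans; <⇒≱; ≰⇒>; m≤n+m; n<1+n; module ≤-Reasoning)
open import Algebra.Properties.CommutativeMonoid.Sum +-0-commutativeMonoid
  using (sum-syntax; sum-cong-≗; sum-replicate-zero; ∑-distrib-+)
open import Data.Product using (∃; ∃-syntax; _×_; _,_; proj₁; proj₂)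
open import Data.Sum using (_⊎_; inj₁; inj₂; swap)
open import Data.Vec as Vec using (count; tabulate)
open import Data.Vec.Properties using (lookup∘tabulate; []=⇒lookup; lookup⇒[]=; ≡-dec)
open import Function using (_∘_; _∘′_; id)
open import Function.Bundles using (_⇔_; mk⇔; module Equivalence)
open Equivalence using (to; from)
open import Relation.Binary.Construct.Closure.ReflexiveTransitive as Star using (Star; ε; _◅_; _◅◅_)
import Relation.Binary.Definitions as B
open import Relation.Binary.PropositionalEquality
  using (_≡_; _≢_; refl; sym; trans; cong; subst; module ≡-Reasoning)
open import Relation.Nullary using (¬_; Dec; yes; no; does; contradiction)
open import Relation.Nullary.Decidable using (dec-true; map′; ¬?; _×-dec_; _⊎-dec_; _→-dec_)
open import Relation.Unary using (Pred; Decidable)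

indicator : ∀ {a} {A : Set a} → Dec A → ℕ
indicator (yes _) = 1
indicator (no _)  = 0

indicator-≤ : ∀ {a} {A : Set a} {m} (A? : Dec A) → (A → 1 ≤ m) → indicator A? ≤ m
indicator-≤ (yes a) 1≤m = 1≤m a
indicator-≤ (no  _) _   = z≤n

∑-mono-≤ : ∀ {n} {f g : Fin n → ℕ} → (∀ i → f i ≤ g i) → ∑[ i < n ] f i ≤ ∑[ i < n ] g i
∑-mono-≤ {zero}  _   = z≤n
∑-mono-≤ {suc n} f≤g = +-mono-≤ (f≤g zero) (∑-mono-≤ (f≤g ∘ suc))

sum-∑-comm : ∀ {b n} {B : Set b} (f : B → Fin n → ℕ) (xs : List B) →
             sum (map (λ x → ∑[ i < n ] f x i) xs) ≡ ∑[ i < n ] sum (map (λ x → f x i) xs)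
sum-∑-comm {n = n} f []       = sym (sum-replicate-zero n)
sum-∑-comm         f (x ∷ xs) = trans (cong (_ +_) (sum-∑-comm f xs)) (sym (∑-distrib-+ (f x) _))

module _ {a p} {A : Set a} {P : Pred A p} (P? : Decidable P) where

  count-tabulate : ∀ {n} (f : Fin n → A) → count P? (tabulate f) ≡ ∑[ i < n ] indicator (P? (f i))
  count-tabulate {zero}  f = refl
  count-tabulate {suc n} f with P? (f zero)
  ... | yes _ = cong suc (count-tabulate (f ∘ suc))
  ... | no  _ = count-tabulate (f ∘ suc)

  count-tabulate-≥1 : ∀ {n} (f : Fin n → A) i → P (f i) → 1 ≤ count P? (tabulate f)
  count-tabulate-≥1 f zero pf0 with P? (f zero)
  ... | yes _  = s≤s z≤n
  ... | no ¬pz = contradiction pf0 ¬pz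
  count-tabulate-≥1 f (suc i) pfi with P? (f zero)
  ... | yes _ = s≤s z≤n
  ... | no  _ = count-tabulate-≥1 (f ∘ suc) i pfi

  sum-indicator-≥1 : ∀ {xs} → Any P xs → 1 ≤ sum (map (indicator ∘ P?) xs)
  sum-indicator-≥1 {x ∷ xs} any with P? x | any
  ... | yes _  | _         = s≤s z≤n
  ... | no ¬px | here px   = contradiction px ¬px
  ... | no _   | there any = sum-indicator-≥1 any

  sum-indicator-≡0 : ∀ {xs} → (∀ {x} → x ∈ₗ xs → ¬ P x) → sum (map (indicator ∘ P?) xs) ≡ 0
  sum-indicator-≡0 {[]}     none = refl
  sum-indicator-≡0 {x ∷ xs} none with P? x
  ... | yes px = contradiction px (none (here refl))
  ... | no  _  = sum-indicator-≡0 (none ∘ there)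

  sum-indicator-≤1 : ∀ {xs} → Unique xs → (∀ {x y} → x ∈ₗ xs → y ∈ₗ xs → P x → P y → x ≡ y) →
                     sum (map (indicator ∘ P?) xs) ≤ 1
  sum-indicator-≤1 {[]}     _             _   = z≤n
  sum-indicator-≤1 {x ∷ xs} (x∉xs ∷ uniq) one with P? x
  ... | yes px = ≤-reflexive (cong suc (sum-indicator-≡0 λ y∈xs py →
                   All.lookup x∉xs y∈xs (one (here refl) (there y∈xs) px py)))
  ... | no  _  = sum-indicator-≤1 uniq λ x∈ y∈ → one (there x∈) (there y∈)

  ∑-indicator-≤1 : ∀ {n} (g : Fin n → A) → (∀ {i j} → P (g i) → P (g j) → i ≡ j) →
                   ∑[ i < n ] indicator (P? (g i)) ≤ 1
  ∑-indicator-≤1 {zero}  g _   = z≤n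
  ∑-indicator-≤1 {suc n} g one with P? (g zero)
  ... | yes p0 = s≤s (≤-trans (∑-mono-≤ λ i → none i) (≤-reflexive (sum-replicate-zero n)))
    where
    none : ∀ i → indicator (P? (g (suc i))) ≤ 0
    none i with P? (g (suc i))
    ... | yes pi = contradiction (one p0 pi) λ ()
    ... | no  _  = z≤n
  ... | no  _  = ∑-indicator-≤1 (g ∘ suc) (λ pi pj → suc-injective (one pi pj))

sum-≤-length : ∀ {b} {B : Set b} (f : B → ℕ) → (∀ x → f x ≤ 1) → ∀ xs → sum (map f xs) ≤ length xs
sum-≤-length f f≤1 []       = z≤n
sum-≤-length f f≤1 (x ∷ xs) = +-mono-≤ (f≤1 x) (sum-≤-length f f≤1 xs)

length-filter≤sum : ∀ {b q} {B : Set b} {Q : Pred B q} (Q? : Decidable Q) (f : B → ℕ) xs →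
                    (∀ {x} → x ∈ₗ xs → Q x → 1 ≤ f x) → length (filter Q? xs) ≤ sum (map f xs)
length-filter≤sum Q? f []       _   = z≤n
length-filter≤sum Q? f (x ∷ xs) pos with Q? x
... | yes qx = +-mono-≤ (pos (here refl) qx) (length-filter≤sum Q? f xs (pos ∘ there))
... | no  _  = ≤-trans (length-filter≤sum Q? f xs (pos ∘ there)) (m≤n+m _ (f x))

module _ {n b p q} {B : Set b} {P : Pred (Fin n) p} {Q : B → Pred (Fin n) q}
         (P? : Decidable P) (Q? : ∀ x → Decidable (Q x)) where

  count-⋃ : ∀ {xs} → Unique xs →
            (∀ {i} → P i → ∃[ x ] x ∈ₗ xs × Q x i) →
            (∀ {i x} → x ∈ₗ xs → Q x i → P i) →
            (∀ {i x y} → x ∈ₗ xs → y ∈ₗ xs → Q x i → Q y i → x ≡ y) →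
            count P? (Vec.allFin n) ≡ sum (map (λ x → count (Q? x) (Vec.allFin n)) xs)
  count-⋃ {xs} uniq cover sound disjoint = begin
    count P? (Vec.allFin n)                              ≡⟨ count-tabulate P? id ⟩
    ∑[ i < n ] indicator (P? i)                          ≡⟨ sum-cong-≗ pointwise ⟩
    ∑[ i < n ] sum (map (λ x → indicator (Q? x i)) xs)   ≡⟨ sum-∑-comm (λ x i → indicator (Q? x i)) xs ⟨
    sum (map (λ x → ∑[ i < n ] indicator (Q? x i)) xs)
      ≡⟨ cong sum (map-cong (λ x → count-tabulate (Q? x) id) xs) ⟨
    sum (map (λ x → count (Q? x) (Vec.allFin n)) xs)     ∎
    where
    open ≡-Reasoning
    pointwise : ∀ i → indicator (P? i) ≡ sum (map (λ x → indicator (Q? x i)) xs)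
    pointwise i with P? i
    ... | yes pi = let x , x∈xs , qxi = cover pi in
                   ≤-antisym (sum-indicator-≥1 (λ x → Q? x i) (Any.map (λ { refl → qxi }) x∈xs))
                             (sum-indicator-≤1 (λ x → Q? x i) uniq (disjoint {i}))
    ... | no ¬pi = sym (sum-indicator-≡0 (λ x → Q? x i) λ x∈xs qxi → ¬pi (sound x∈xs qxi))

module _ {n b p} {B : Set b} {P : Pred (Fin n) p} (P? : Decidable P) (_≟_ : B.DecidableEquality B) where

  count≤length : ∀ (f : Fin n → B) xs →
                 (∀ {i} → P i → f i ∈ₗ xs) → (∀ {i j} → P i → P j → f i ≡ f j → i ≡ j) →
                 count P? (Vec.allFin n) ≤ length xs
  count≤length f xs into injective = begin
    count P? (Vec.allFin n)                               ≡⟨ count-tabulate P? id ⟩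
    ∑[ i < n ] indicator (P? i)                           ≤⟨ ∑-mono-≤ pointwise ⟩
    ∑[ i < n ] sum (map (λ x → indicator (hit x i)) xs)   ≡⟨ sum-∑-comm (λ x i → indicator (hit x i)) xs ⟨
    sum (map (λ x → ∑[ i < n ] indicator (hit x i)) xs)   ≤⟨ sum-≤-length _ fibre≤1 xs ⟩
    length xs                                             ∎
    where
    open ≤-Reasoning
    hit : ∀ x i → Dec (P i × f i ≡ x)
    hit x i = P? i ×-dec (f i ≟ x)
    pointwise : ∀ i → indicator (P? i) ≤ sum (map (λ x → indicator (hit x i)) xs)
    pointwise i = indicator-≤ (P? i) λ pi →
      sum-indicator-≥1 (λ x → hit x i) (Any.map (λ fi≡x → pi , fi≡x) (into pi))
    fibre≤1 : ∀ x → ∑[ i < n ] indicator (hit x i) ≤ 1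
    fibre≤1 x = ∑-indicator-≤1 (hit x) id λ (pi , fi≡x) (pj , fj≡x) → injective pi pj (trans fi≡x (sym fj≡x))

module _ {n p} {P : Pred (Fin n) p} (P? : Decidable P) where

  subset : Subset n
  subset = tabulate (does ∘ P?)

  ∈-subset⁺ : ∀ {x} → P x → x ∈ subset
  ∈-subset⁺ {x} px = lookup⇒[]= x _ (trans (lookup∘tabulate _ x) (dec-true (P? x) px))

  ∈-subset⁻ : ∀ {x} → x ∈ subset → P x
  ∈-subset⁻ {x} x∈ with P? x | trans (sym (lookup∘tabulate (does ∘ P?) x)) ([]=⇒lookup x∈)
  ... | yes px | _  = px
  ... | no  _  | ()

module _ {n} {R : Fin n → Fin n → Set} (R? : B.Decidable R) where

  open import Data.List.Membership.DecPropositional (_≟_ {n}) using () renaming (_∈?_ to _∈ₗ?_)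

  private
    Within : List (Fin n) → Fin n → Fin n → Set
    Within U = Star (λ x y → R x y × y ∈ₗ U)

    _─_ : List (Fin n) → Fin n → List (Fin n)
    U ─ x = filter (¬? ∘ (_≟ x)) U

    ─⊆ : ∀ {U x y} → y ∈ₗ U ─ x → y ∈ₗ U
    ─⊆ = proj₁ ∘ ∈-filter⁻ _

    within-lastExit : ∀ {U x a y} → Within U a y →
      y ≡ x ⊎ (a ≢ x × Within (U ─ x) a y) ⊎ (∃[ z ] R x z × z ∈ₗ U ─ x × Within (U ─ x) z y)
    within-lastExit {x = x} {a} ε with a ≟ x
    ... | yes a≡x = inj₁ a≡x
    ... | no  a≢x = inj₂ (inj₁ (a≢x , ε))
    within-lastExit {x = x} {a} ((Rab , b∈U) ◅ walk) with within-lastExit walk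
    ... | inj₁ y≡x                  = inj₁ y≡x
    ... | inj₂ (inj₂ exit)          = inj₂ (inj₂ exit)
    ... | inj₂ (inj₁ (b≢x , avoid)) with a ≟ x
    ...   | yes refl = inj₂ (inj₂ (_ , Rab , ∈-filter⁺ _ b∈U b≢x , avoid))
    ...   | no  a≢x  = inj₂ (inj₁ (a≢x , (Rab , ∈-filter⁺ _ b∈U b≢x) ◅ avoid))

    -- Depth-first search: a walk out of x may be cut at its last departure from x, after which it
    -- never uses x again, so the search from the successors of x runs in the smaller list U ─ x.
    within? : ∀ k U → length U ≤ k → ∀ {x} → x ∈ₗ U → ∀ y → Dec (Within U x y)
    within? zero    []      _    ()
    within? (suc k) U len≤ {x} x∈U y with x ≟ y
    ... | yes refl = yes ε
    ... | no  x≢y  with any? exitTo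
      where
      len─≤ : length (U ─ x) ≤ k
      len─≤ = ≤-pred (<-≤-trans (filter-notAll _ U (Any.map (λ x≡z z≢x → z≢x (sym x≡z)) x∈U)) len≤)
      exitTo : ∀ z → Dec (R x z × z ∈ₗ U ─ x × Within (U ─ x) z y)
      exitTo z with R? x z | z ∈ₗ? U ─ x
      ... | no ¬Rxz | _       = no (¬Rxz ∘ proj₁)
      ... | yes _   | no  z∉  = no (z∉ ∘ proj₁ ∘ proj₂)
      ... | yes Rxz | yes z∈  = map′ (λ walk → Rxz , z∈ , walk) (proj₂ ∘ proj₂) (within? k (U ─ x) len─≤ z∈ y)
    ... | yes (z , Rxz , z∈ , walk) = yes ((Rxz , ─⊆ z∈) ◅ Star.map (λ (Rab , b∈) → Rab , ─⊆ b∈) walk)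
    ... | no  ¬exit = no λ walk → case (within-lastExit walk)
      where
      case : y ≡ x ⊎ (x ≢ x × Within (U ─ x) x y) ⊎ (∃[ z ] R x z × z ∈ₗ U ─ x × Within (U ─ x) z y) → ⊥
      case (inj₁ y≡x)              = x≢y (sym y≡x)
      case (inj₂ (inj₁ (x≢x , _))) = x≢x refl
      case (inj₂ (inj₂ exit))      = ¬exit exit

  star? : B.Decidable (Star R)
  star? x y = map′ (Star.map proj₁) (Star.map (λ {_} {b} Rab → Rab , ∈-allFin b))
                   (within? n (allFin n) (≤-reflexive (length-tabulate id)) (∈-allFin x) y)

module _ {a} {A : Set a} where

  lookup-injective : ∀ {xs : List A} → Unique xs → ∀ {i j} → lookup xs i ≡ lookup xs j → i ≡ j
  lookup-injective {x ∷ xs} _           {zero}  {zero}  _ = refl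
  lookup-injective {x ∷ xs} (x∉xs ∷ _)  {zero}  {suc j} e = contradiction e (All.lookup x∉xs (∈-lookup j))
  lookup-injective {x ∷ xs} (x∉xs ∷ _)  {suc i} {zero}  e = contradiction (sym e) (All.lookup x∉xs (∈-lookup i))
  lookup-injective {x ∷ xs} (_ ∷ uniq)  {suc i} {suc j} e = cong suc (lookup-injective uniq e)

  Unique-∷-prefix : ∀ xs {w : A} {ys} → Unique (xs ++ w ∷ ys) → Unique (w ∷ xs)
  Unique-∷-prefix []       _               = [] ∷ []
  Unique-∷-prefix (x ∷ xs) {w} (x∉rest ∷ uniq) with Unique-∷-prefix xs uniq
  ... | w∉xs ∷ uniqxs = (x≢w ∘′ sym ∷ w∉xs) ∷ ++⁻ˡ xs x∉rest ∷ uniqxs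
    where
    x≢w : x ≢ w
    x≢w = All.lookup x∉rest (∈-++⁺ʳ xs (here refl))

module _ {a r} {A : Set a} {R : A → A → Set r} where

  Linked-prefix : ∀ xs {w : A} {ys} → Linked R (xs ++ w ∷ ys) → Linked R (xs ++ [ w ])
  Linked-prefix []           _        = [-]
  Linked-prefix (x ∷ [])     (r ∷ _)  = r ∷ [-]
  Linked-prefix (x ∷ y ∷ xs) (r ∷ rs) = r ∷ Linked-prefix (y ∷ xs) rs

  Linked⇒lookup : ∀ x xs {z} → Linked R (x ∷ xs ++ [ z ]) →
                  (∀ (j : Fin (length xs)) → R (lookup (x ∷ xs) (inject₁ j)) (lookup (x ∷ xs) (suc j)))
                  × R (lookup (x ∷ xs) (fromℕ (length xs))) z
  Linked⇒lookup x []       (r ∷ [-]) = (λ ()) , r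
  Linked⇒lookup x (y ∷ xs) (r ∷ rs)  with Linked⇒lookup y xs rs
  ... | steps , last = (λ { zero → r ; (suc j) → steps j }) , last

Unique⇒length≤ : ∀ {n} {xs : List (Fin n)} → Unique xs → length xs ≤ n
Unique⇒length≤ uniq = injective⇒≤ (lookup-injective uniq)

module _ {n} (R : Fin n → Fin n → Set) where

  Sourceless : Subset n → Set
  Sourceless T = Nonempty T × (∀ v → v ∈ T → ∃[ u ] u ∈ T × R u v)

  CycleIn : Subset n → Set
  CycleIn T = ∃[ c₀ ] ∃[ c₁ ] ∃[ cs ]
    Unique (c₀ ∷ c₁ ∷ cs) × All (_∈ T) (c₀ ∷ c₁ ∷ cs) × Linked R (c₀ ∷ c₁ ∷ cs ++ [ c₀ ])

  sourceless⇒cycle : (∀ {x} → ¬ R x x) → ∀ {T} → Sourceless T → CycleIn T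
  sourceless⇒cycle irrefl {T} ((x , x∈T) , predecessor) =
    walk n x [] (n<1+n n) ([] ∷ []) [-] (x∈T ∷ [])
    where
    open import Data.List.Membership.DecPropositional (_≟_ {n}) using () renaming (_∈?_ to _∈ₗ?_)
    -- v ∷ vs is the walk so far, newest vertex first, traced backwards from x along incoming
    -- arcs without repetitions; a list of distinct vertices has length at most n, so a repetition
    -- occurs within the fuel, and the first one closes a cycle (of length ≥ 2: R has no loops).
    walk : ∀ k v vs → n < length (v ∷ vs) + k →
           Unique (v ∷ vs) → Linked R (v ∷ vs) → All (_∈ T) (v ∷ vs) → CycleIn T
    walk zero v vs n<len uniq _ _ =
      contradiction (Unique⇒length≤ uniq) (<⇒≱ (subst (n <_) (+-identityʳ _) n<len))
    walk (suc k) v vs n<len uniq linked all@(v∈T ∷ _) with predecessor v v∈T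
    ... | u , u∈T , u→v with u ∈ₗ? v ∷ vs
    ...   | no u∉ = walk k u (v ∷ vs) (subst (n <_) (+-suc _ k) n<len)
                       (¬Any⇒All¬ _ u∉ ∷ uniq) (u→v ∷ linked) (u∈T ∷ all)
    ...   | yes u∈ with ∈-∃++ u∈
    ...     | []     , _ , refl = contradiction u→v irrefl
    ...     | _ ∷ us , _ , refl = u , v , us , Unique-∷-prefix (v ∷ us) uniq
                                , u∈T ∷ ++⁻ˡ (v ∷ us) all , u→v ∷ Linked-prefix (v ∷ us) linked

Enumerates-filter : ∀ {A : Set} {P Q : A → Set} (Q? : Decidable Q) {xs} →
                    Enumerates P xs → Enumerates (λ a → P a × Q a) (filter Q? xs)
Enumerates-filter Q? (uniq , members) =
  filter⁺ Q? uniq , λ a → mk⇔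
    (λ a∈ → let a∈xs , qa = ∈-filter⁻ Q? a∈ in to (members a) a∈xs , qa)
    (λ (pa , qa) → ∈-filter⁺ Q? (from (members a) pa) qa)

module _ {n h : ℕ} (μ : ℕ) (p : Profile n h) where

  support-self≤0 : ∀ x → support μ p x x ≤ 0
  support-self≤0 x = begin
    support μ p x x                       ≡⟨ count-tabulate (λ i → x >[ p i ]? x) id ⟩
    ∑[ i < h ] indicator (x >[ p i ]? x)  ≤⟨ ∑-mono-≤ (λ i → indicator-≤ (x >[ p i ]? x) (never i)) ⟩
    ∑[ i < h ] 0                          ≡⟨ sum-replicate-zero h ⟩
    0                                     ∎
    where
    open ≤-Reasoning
    never : ∀ i → x >[ p i ] x → 1 ≤ 0
    never i x>x = contradiction x>x (<-irrefl refl)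

  Arc-irreflexive : 0 < μ → ∀ {x} → ¬ Arc μ p x x
  Arc-irreflexive 0<μ {x} μ≤support = contradiction (≤-trans 0<μ (≤-trans μ≤support (support-self≤0 x))) λ ()

  InD⇔noArcInto : ∀ {x} → InD μ p x ⇔ (∀ y → ¬ Arc μ p y x)
  InD⇔noArcInto = mk⇔ (λ d y → <⇒≱ (d y)) (λ noArc y → ≰⇒> (noArc y))

  Adj? : B.Decidable (Adj μ p)
  Adj? x y = Arc? μ p x y ⊎-dec Arc? μ p y x

  Connected-sym : ∀ {x y} → Connected μ p x y → Connected μ p y x
  Connected-sym = Star.reverse swap

  component : Fin n → Subset n
  component x = subset (star? Adj? x)

  ∈-component⁺ : ∀ {x y} → Connected μ p x y → y ∈ component x
  ∈-component⁺ = ∈-subset⁺ (star? Adj? _)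

  ∈-component⁻ : ∀ {x y} → y ∈ component x → Connected μ p x y
  ∈-component⁻ = ∈-subset⁻ (star? Adj? _)

  component-isComponent : ∀ x → IsComponent μ p (component x)
  component-isComponent x =
      (x , ∈-component⁺ ε)
    , (λ _ _ y∈ z∈ → Connected-sym (∈-component⁻ y∈) ◅◅ ∈-component⁻ z∈)
    , (λ _ _ y∈ y~z → ∈-component⁺ (∈-component⁻ y∈ ◅◅ y~z ◅ ε))

  IsComponent-closed : ∀ {S} → IsComponent μ p S → ∀ {x y} → x ∈ S → Connected μ p x y → y ∈ S
  IsComponent-closed _               x∈S ε           = x∈S
  IsComponent-closed c@(_ , _ , adj) x∈S (x~z ◅ z⇝y) = IsComponent-closed c (adj _ _ x∈S x~z) z⇝y

  IsComponent⇒≡component : ∀ {S x} → IsComponent μ p S → x ∈ S → S ≡ component x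
  IsComponent⇒≡component c@(_ , connected , _) x∈S =
    ⊆-antisym (λ y∈S → ∈-component⁺ (connected _ _ x∈S y∈S))
              (λ y∈ → IsComponent-closed c x∈S (∈-component⁻ y∈))

  InMax⇔noArcInto : ∀ {S x} → IsComponent μ p S → x ∈ S → InMax μ p S x ⇔ (∀ y → ¬ Arc μ p y x)
  InMax⇔noArcInto (_ , _ , adj) x∈S =
    mk⇔ (λ (_ , noArc) y y→x → noArc y (adj _ _ x∈S (inj₂ y→x) , y→x))
        (λ noArc → x∈S , λ y (_ , y→x) → noArc y y→x)

  InD⇔InMax : ∀ x → InD μ p x ⇔ (∃[ S ] IsComponent μ p S × InMax μ p S x)
  InD⇔InMax x = mk⇔
    (λ d → component x , c , from (InMax⇔noArcInto c (∈-component⁺ ε)) (to InD⇔noArcInto d))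
    (λ (S , c , max@(x∈S , _)) → from InD⇔noArcInto (to (InMax⇔noArcInto c x∈S) max))
    where
    c : IsComponent μ p (component x)
    c = component-isComponent x

  isolated⇒∈component⇒≡ : ∀ {x y} → Isolated μ p x → y ∈ component x → y ≡ x
  isolated⇒∈component⇒≡ iso y∈ with ∈-component⁻ y∈
  ... | ε            = refl
  ... | inj₁ x→z ◅ _ = contradiction x→z (proj₁ (iso _))
  ... | inj₂ z→x ◅ _ = contradiction z→x (proj₂ (iso _))

  subsingleton⇒acyclic : ∀ {S x} → (∀ {y} → y ∈ S → y ≡ x) → ¬ HasCycle μ p S
  subsingleton⇒acyclic ≡x (_ , xs , injective , xs∈S , _) =
    contradiction (injective (trans (≡x (xs∈S zero)) (sym (≡x (xs∈S (suc zero)))))) λ ()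

  isolated⇒acyclicComponent : ∀ {x} → Isolated μ p x →
                              IsAcyclicComponent μ p (component x) × InMax μ p (component x) x
  isolated⇒acyclicComponent {x} iso =
      (component-isComponent x , subsingleton⇒acyclic (isolated⇒∈component⇒≡ iso))
    , (∈-component⁺ ε , λ y (_ , y→x) → proj₂ (iso y) y→x)

  HasCycle⇒Sourceless : ∀ {S} → HasCycle μ p S → ∃[ T ] T ⊆ S × Sourceless (Arc μ p) T
  HasCycle⇒Sourceless {S} (_ , xs , _ , xs∈S , steps , close) =
    image , image⊆S , (xs zero , ∈-subset⁺ onCycle? (zero , refl)) , predecessor
    where
    onCycle? : Decidable (λ y → ∃[ j ] xs j ≡ y)
    onCycle? y = any? (λ j → xs j ≟ y)
    image : Subset n
    image = subset onCycle?
    image⊆S : image ⊆ S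
    image⊆S y∈ with ∈-subset⁻ onCycle? y∈
    ... | j , refl = xs∈S j
    predecessor : ∀ v → v ∈ image → ∃[ u ] u ∈ image × Arc μ p u v
    predecessor v v∈ with ∈-subset⁻ onCycle? v∈
    ... | zero  , refl = _ , ∈-subset⁺ onCycle? (_ , refl) , close
    ... | suc j , refl = _ , ∈-subset⁺ onCycle? (_ , refl) , steps j

  components : List (Subset n)
  components = deduplicate (≡-dec Bool._≟_) (map component (allFin n))

  ∈-components : ∀ {S} → S ∈ₗ components ⇔ IsComponent μ p S
  ∈-components = mk⇔
    (λ S∈ → let x , _ , S≡ = ∈-map⁻ component (∈-deduplicate⁻ (≡-dec Bool._≟_) _ S∈) in
            subst (IsComponent μ p) (sym S≡) (component-isComponent x))
    (λ c@((x , x∈S) , _) → ∈-deduplicate⁺ (≡-dec Bool._≟_)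
            (subst (_∈ₗ _) (sym (IsComponent⇒≡component c x∈S)) (∈-map⁺ component (∈-allFin x))))

  components-enumerate : Enumerates (IsComponent μ p) components
  components-enumerate = deduplicate-! (≡-dec Bool._≟_) _ , λ _ → ∈-components

  cardD≡sum-cardMax : cardD μ p ≡ sum (map (cardMax μ p) components)
  cardD≡sum-cardMax = count-⋃ (InD? μ p) (InMax? μ p) (proj₁ components-enumerate)
    (λ {x} d → let S , c , max = to (InD⇔InMax x) d in S , from ∈-components c , max)
    (λ {x} {S} S∈ max → from (InD⇔InMax x) (S , to ∈-components S∈ , max))
    (λ S∈ T∈ (x∈S , _) (x∈T , _) → trans (IsComponent⇒≡component (to ∈-components S∈) x∈S)
                                    (sym (IsComponent⇒≡component (to ∈-components T∈) x∈T)))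

  module _ (0<μ : 0 < μ) where

    Sourceless⇒HasCycle : ∀ {S T} → T ⊆ S → Sourceless (Arc μ p) T → HasCycle μ p S
    Sourceless⇒HasCycle T⊆S sourceless with sourceless⇒cycle (Arc μ p) (Arc-irreflexive 0<μ) sourceless
    ... | c₀ , c₁ , cs , uniq , cs∈T , linked =
      let steps , close = Linked⇒lookup c₀ (c₁ ∷ cs) linked in
      _ , lookup (c₀ ∷ c₁ ∷ cs) , lookup-injective uniq
        , (λ j → T⊆S (All.lookup cs∈T (∈-lookup j))) , steps , close

    hasCycle? : Decidable (HasCycle μ p)
    hasCycle? S = map′ (λ (_ , T⊆S , sourceless) → Sourceless⇒HasCycle T⊆S sourceless) HasCycle⇒Sourceless
                       (anySubset? λ T → T ⊆? S ×-dec sourceless? T)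
      where
      sourceless? : Decidable (Sourceless (Arc μ p))
      sourceless? T = nonempty? T ×-dec all? λ v → v ∈? T →-dec any? λ u → u ∈? T ×-dec Arc? μ p u v

    acyclic⇒max : ∀ {S} → Nonempty S → ¬ HasCycle μ p S → ∃ (InMax μ p S)
    acyclic⇒max {S} nonempty acyclic with any? (InMax? μ p S)
    ... | yes max = max
    ... | no ¬max = contradiction (Sourceless⇒HasCycle id (nonempty , predecessor)) acyclic
      where
      predecessor : ∀ v → v ∈ S → ∃[ u ] u ∈ S × Arc μ p u v
      predecessor v v∈S with any? (λ u → u ∈? S ×-dec Arc? μ p u v)
      ... | yes found = found
      ... | no  none  = contradiction (v , v∈S , λ u u→v → none (u , u→v)) ¬max

    acyclicComponents : List (Subset n)
    acyclicComponents = filter (¬? ∘ hasCycle?) components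

    acyclicComponents-enumerate : Enumerates (IsAcyclicComponent μ p) acyclicComponents
    acyclicComponents-enumerate = Enumerates-filter (¬? ∘ hasCycle?) components-enumerate

    length-acyclicComponents≤sum-cardMax : length acyclicComponents ≤ sum (map (cardMax μ p) components)
    length-acyclicComponents≤sum-cardMax = length-filter≤sum (¬? ∘ hasCycle?) (cardMax μ p) components
      λ {S} S∈ acyclic → let x , max = acyclic⇒max (proj₁ (to ∈-components S∈)) acyclic in
                         count-tabulate-≥1 (InMax? μ p S) id x max

    cardI≤length-acyclicComponents : cardI μ p ≤ length acyclicComponents
    cardI≤length-acyclicComponents =
      count≤length (Isolated? μ p) (≡-dec Bool._≟_) component acyclicComponents
        (λ iso → from (proj₂ acyclicComponents-enumerate _) (proj₁ (isolated⇒acyclicComponent iso)))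
        (λ {_} {y} isoˣ _ same → sym (isolated⇒∈component⇒≡ isoˣ (subst (y ∈_) (sym same) (∈-component⁺ ε))))

<2*⇒>0 : ∀ {h} μ → h < 2 * μ → 0 < μ
<2*⇒>0 (suc _) _ = s≤s z≤n

proposition13 : (n h μ : ℕ) → 2 ≤ n → 2 ≤ h → h < 2 * μ → μ ≤ h →
    (p : Profile n h) →
      (∀ x → InD μ p x ⇔ (∃[ S ] IsComponent μ p S × InMax μ p S x))
    × (∀ x → (∃[ S ] IsAcyclicComponent μ p S × InMax μ p S x) →
             (∃[ S ] IsComponent μ p S × InMax μ p S x))
    × (∀ x → Isolated μ p x →
             (∃[ S ] IsAcyclicComponent μ p S × InMax μ p S x))
    × (∃[ cs ] ∃[ as ]
          Enumerates (IsComponent μ p) cs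
        × Enumerates (IsAcyclicComponent μ p) as
        × cardD μ p ≡ sum (map (cardMax μ p) cs)
        × sum (map (cardMax μ p) cs) ≥ length as
        × length as ≥ cardI μ p)
proposition13 n h μ _ _ h<2μ _ p =
    InD⇔InMax μ p
  , (λ _ (S , (c , _) , max) → S , c , max)
  , (λ x iso → component μ p x , isolated⇒acyclicComponent μ p iso)
  , components μ p , acyclicComponents μ p 0<μ
  , components-enumerate μ p , acyclicComponents-enumerate μ p 0<μ
  , cardD≡sum-cardMax μ p
  , length-acyclicComponents≤sum-cardMax μ p 0<μ
  , cardI≤length-acyclicComponents μ p 0<μ
  where
  0<μ : 0 < μ
  0<μ = <2*⇒>0 μ h<2μ
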